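{- Let $\mathcal{F}$ be an intersecting $3$-graph on $[n]$ that covers pairs (for every $i,j\in[n]$ some edge contains $\{i,j\}$), such that for every $A\in\mathcal{F}$ and every $i\in A$ there is $B\in\mathcal{F}$ with $A\cap B=\{i\}$. Then $n\le7$.
   Context: Intersecting means every two edges share a vertex. -}

module Defs where

open import Data.Nat using (ℕ)
open import Data.Fin using (Fin)
open import Data.Fin.Subset using (Subset; _∈_; _∩_; ∣_∣; Nonempty; ⁅_⁆)
open import Data.List using (List)
import Data.List.Membership.Propositional as L
open import Data.Product using (Σ; _×_; ∃)
open import Relation.Binary.PropositionalEquality using (_≡_; _≢_)

Is3Graph : {n : ℕ} → List (Subset n) → Set
Is3Graph {n} F = ∀ A → A L.∈ F → ∣ A ∣ ≡ 3

Intersecting : {n : ℕ} → List (Subset n) → Set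
Intersecting F = ∀ A B → A L.∈ F → B L.∈ F → Nonempty (A ∩ B)

CoversPairs : {n : ℕ} → List (Subset n) → Set
CoversPairs {n} F = (i j : Fin n) → i ≢ j → Σ (Subset n) λ A → A L.∈ F × (i ∈ A × j ∈ A)

SinglePointProperty : {n : ℕ} → List (Subset n) → Set
SinglePointProperty {n} F =
  ∀ A → A L.∈ F → (i : Fin n) → i ∈ A → Σ (Subset n) λ B → B L.∈ F × (A ∩ B ≡ ⁅ i ⁆)

-- Fix edges E, D with E ∩ D = {u}, so that |E ∪ D| = 5. An edge avoiding u meets both E ∖ D
-- and D ∖ E, so it has at most one vertex outside E ∪ D; hence an edge through two outside
-- vertices contains u. If n ≥ 8 there are three outside vertices a, b, c, and the edge G′
-- through b, c is {u, b, c}. For an edge G through a, b, the edge H with G ∩ H = {a} avoids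
-- u and b, so it meets G′ in c; but then H avoids u and contains two outside vertices a, c.
module Submission where

open import Defs
open import Data.Nat using (ℕ; suc; _+_; _≤_; _<_; s≤s)
open import Data.Nat.Properties
  using ( ≤-trans; ≤-reflexive; +-suc; +-comm; +-cancelʳ-≡; +-monoʳ-≤; m≤m+n; m≤n+m; _≤?_; ≰⇒>
        ; module ≤-Reasoning)
open import Data.Fin using (Fin; zero; suc; _≟_)
open import Data.Fin.Subset hiding (⊥)
open import Data.Fin.Subset.Properties
open import Data.Bool using (true; false)
open import Data.Vec using (_∷_; [])
open import Data.List using (List)
import Data.List.Membership.Propositional as List
open import Data.Product using (∃; _×_; _,_; proj₁; proj₂)
import Data.Product as Product
open import Data.Sum using (_⊎_; inj₁; inj₂)
open import Data.Empty using (⊥; ⊥-elim)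
open import Function using (_∘_)
open import Relation.Nullary using (yes; no; contradiction)
open import Relation.Binary.PropositionalEquality
  using (_≡_; _≢_; refl; sym; trans; cong; cong₂; subst; ≢-sym; module ≡-Reasoning)

private
  variable
    n : ℕ
    p q : Subset n
    a b c d x y : Fin n

∣p∪q∣+∣p∩q∣≡∣p∣+∣q∣ : (p q : Subset n) → ∣ p ∪ q ∣ + ∣ p ∩ q ∣ ≡ ∣ p ∣ + ∣ q ∣
∣p∪q∣+∣p∩q∣≡∣p∣+∣q∣ [] [] = refl
∣p∪q∣+∣p∩q∣≡∣p∣+∣q∣ (true ∷ p) (true ∷ q) =
  cong suc (trans (+-suc _ _) (trans (cong suc (∣p∪q∣+∣p∩q∣≡∣p∣+∣q∣ p q)) (sym (+-suc _ _))))
∣p∪q∣+∣p∩q∣≡∣p∣+∣q∣ (true ∷ p) (false ∷ q) = cong suc (∣p∪q∣+∣p∩q∣≡∣p∣+∣q∣ p q)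
∣p∪q∣+∣p∩q∣≡∣p∣+∣q∣ (false ∷ p) (true ∷ q) =
  trans (cong suc (∣p∪q∣+∣p∩q∣≡∣p∣+∣q∣ p q)) (sym (+-suc _ _))
∣p∪q∣+∣p∩q∣≡∣p∣+∣q∣ (false ∷ p) (false ∷ q) = ∣p∪q∣+∣p∩q∣≡∣p∣+∣q∣ p q

∣p∪q∣≤∣p∣+∣q∣ : (p q : Subset n) → ∣ p ∪ q ∣ ≤ ∣ p ∣ + ∣ q ∣
∣p∪q∣≤∣p∣+∣q∣ p q = ≤-trans (m≤m+n _ _) (≤-reflexive (∣p∪q∣+∣p∩q∣≡∣p∣+∣q∣ p q))

∣p∪⁅x⁆∣≤1+∣p∣ : (p : Subset n) (x : Fin n) → ∣ p ∪ ⁅ x ⁆ ∣ ≤ suc ∣ p ∣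
∣p∪⁅x⁆∣≤1+∣p∣ p x = ≤-trans (∣p∪q∣≤∣p∣+∣q∣ p ⁅ x ⁆)
  (≤-reflexive (trans (cong (∣ p ∣ +_) (∣⁅x⁆∣≡1 x)) (+-comm ∣ p ∣ 1)))

∣p∣≡3⇒∣q∣≡3⇒∣p∩q∣≡1⇒∣p∪q∣≡5 : (p q : Subset n) → ∣ p ∣ ≡ 3 → ∣ q ∣ ≡ 3 → ∣ p ∩ q ∣ ≡ 1 →
                                ∣ p ∪ q ∣ ≡ 5
∣p∣≡3⇒∣q∣≡3⇒∣p∩q∣≡1⇒∣p∪q∣≡5 p q ∣p∣≡3 ∣q∣≡3 ∣p∩q∣≡1 = +-cancelʳ-≡ 1 _ 5 (begin
  ∣ p ∪ q ∣ + 1           ≡⟨ cong (∣ p ∪ q ∣ +_) (sym ∣p∩q∣≡1) ⟩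
  ∣ p ∪ q ∣ + ∣ p ∩ q ∣   ≡⟨ ∣p∪q∣+∣p∩q∣≡∣p∣+∣q∣ p q ⟩
  ∣ p ∣ + ∣ q ∣           ≡⟨ cong₂ _+_ ∣p∣≡3 ∣q∣≡3 ⟩
  6                       ∎)
  where open ≡-Reasoning

∣p∣<n⇒∃∉ : (p : Subset n) → ∣ p ∣ < n → ∃ λ x → x ∉ p
∣p∣<n⇒∃∉ (false ∷ p) _ = zero , λ ()
∣p∣<n⇒∃∉ (true ∷ p) (s≤s ∣p∣<n) = Product.map suc (_∘ drop-there) (∣p∣<n⇒∃∉ p ∣p∣<n)

x∉p∪q⇒x∉p : x ∉ p ∪ q → x ∉ p
x∉p∪q⇒x∉p x∉p∪q = x∉p∪q ∘ x∈p∪q⁺ ∘ inj₁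

x∉p∪q⇒x∉q : x ∉ p ∪ q → x ∉ q
x∉p∪q⇒x∉q x∉p∪q = x∉p∪q ∘ x∈p∪q⁺ ∘ inj₂

x∉p∪⁅y⁆⇒x≢y : x ∉ p ∪ ⁅ y ⁆ → x ≢ y
x∉p∪⁅y⁆⇒x≢y = x∉⁅y⁆⇒x≢y ∘ x∉p∪q⇒x∉q

three-distinct-∉ : (p : Subset n) → 3 + ∣ p ∣ ≤ n →
                   ∃ λ a → ∃ λ b → ∃ λ c → a ∉ p × b ∉ p × c ∉ p × a ≢ b × a ≢ c × b ≢ c
three-distinct-∉ p 3+∣p∣≤n
  with a , a∉p ← ∣p∣<n⇒∃∉ p (≤-trans (m≤n+m _ 2) 3+∣p∣≤n)
  with b , b∉p∪a ← ∣p∣<n⇒∃∉ (p ∪ ⁅ a ⁆)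
         (≤-trans (s≤s (∣p∪⁅x⁆∣≤1+∣p∣ p a)) (≤-trans (m≤n+m _ 1) 3+∣p∣≤n))
  with c , c∉p∪a∪b ← ∣p∣<n⇒∃∉ ((p ∪ ⁅ a ⁆) ∪ ⁅ b ⁆)
         (≤-trans (s≤s (≤-trans (∣p∪⁅x⁆∣≤1+∣p∣ (p ∪ ⁅ a ⁆) b) (s≤s (∣p∪⁅x⁆∣≤1+∣p∣ p a)))) 3+∣p∣≤n)
  = a , b , c , a∉p , x∉p∪q⇒x∉p b∉p∪a , x∉p∪q⇒x∉p (x∉p∪q⇒x∉p c∉p∪a∪b)
  , ≢-sym (x∉p∪⁅y⁆⇒x≢y b∉p∪a) , ≢-sym (x∉p∪⁅y⁆⇒x≢y (x∉p∪q⇒x∉p c∉p∪a∪b))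
  , ≢-sym (x∉p∪⁅y⁆⇒x≢y c∉p∪a∪b)

four-distinct⇒4≤∣p∣ : a ∈ p → b ∈ p → c ∈ p → d ∈ p →
                      a ≢ b → a ≢ c → a ≢ d → b ≢ c → b ≢ d → c ≢ d → 4 ≤ ∣ p ∣
four-distinct⇒4≤∣p∣ {a = a} {p = p} {b = b} {c = c} {d = d}
                    a∈p b∈p c∈p d∈p a≢b a≢c a≢d b≢c b≢d c≢d = begin
  4                           ≤⟨ m≤m+n 4 _ ⟩
  4 + ∣ p - a - b - c - d ∣   ≤⟨ +-monoʳ-≤ 3 (x∈p⇒∣p-x∣<∣p∣ d∈p-a-b-c) ⟩
  3 + ∣ p - a - b - c ∣       ≤⟨ +-monoʳ-≤ 2 (x∈p⇒∣p-x∣<∣p∣ c∈p-a-b) ⟩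
  2 + ∣ p - a - b ∣           ≤⟨ +-monoʳ-≤ 1 (x∈p⇒∣p-x∣<∣p∣ b∈p-a) ⟩
  1 + ∣ p - a ∣               ≤⟨ x∈p⇒∣p-x∣<∣p∣ a∈p ⟩
  ∣ p ∣                       ∎
  where
  open ≤-Reasoning
  b∈p-a = x∈p∧x≢y⇒x∈p-y b∈p (≢-sym a≢b)
  c∈p-a-b = x∈p∧x≢y⇒x∈p-y (x∈p∧x≢y⇒x∈p-y c∈p (≢-sym a≢c)) (≢-sym b≢c)
  d∈p-a-b-c =
    x∈p∧x≢y⇒x∈p-y (x∈p∧x≢y⇒x∈p-y (x∈p∧x≢y⇒x∈p-y d∈p (≢-sym a≢d)) (≢-sym b≢d)) (≢-sym c≢d)

∣p∣≡3⇒x≡a⊎x≡b⊎x≡c : ∣ p ∣ ≡ 3 → a ∈ p → b ∈ p → c ∈ p → a ≢ b → a ≢ c → b ≢ c →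
                     x ∈ p → x ≡ a ⊎ x ≡ b ⊎ x ≡ c
∣p∣≡3⇒x≡a⊎x≡b⊎x≡c {a = a} {b = b} {c = c} {x = x} ∣p∣≡3 a∈p b∈p c∈p a≢b a≢c b≢c x∈p
  with x ≟ a | x ≟ b | x ≟ c
... | yes x≡a | _       | _       = inj₁ x≡a
... | no _    | yes x≡b | _       = inj₂ (inj₁ x≡b)
... | no _    | no _    | yes x≡c = inj₂ (inj₂ x≡c)
... | no x≢a  | no x≢b  | no x≢c  =
  contradiction (subst (4 ≤_) ∣p∣≡3 4≤∣p∣) λ { (s≤s (s≤s (s≤s ()))) }
  where
  4≤∣p∣ = four-distinct⇒4≤∣p∣ a∈p b∈p c∈p x∈p a≢b a≢c (≢-sym x≢a) b≢c (≢-sym x≢b) (≢-sym x≢c)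

x∈p⇒y∉p⇒x≢y : x ∈ p → y ∉ p → x ≢ y
x∈p⇒y∉p⇒x≢y x∈p y∉p refl = y∉p x∈p

p∩q≡⁅y⁆⇒x≡y : p ∩ q ≡ ⁅ y ⁆ → x ∈ p → x ∈ q → x ≡ y
p∩q≡⁅y⁆⇒x≡y {y = y} p∩q≡⁅y⁆ x∈p x∈q =
  x∈⁅y⁆⇒x≡y y (subst (_ ∈_) p∩q≡⁅y⁆ (x∈p∩q⁺ (x∈p , x∈q)))

p∩q≡⁅y⁆⇒y∈p×y∈q : (p q : Subset n) → p ∩ q ≡ ⁅ y ⁆ → y ∈ p × y ∈ q
p∩q≡⁅y⁆⇒y∈p×y∈q p q p∩q≡⁅y⁆ = x∈p∩q⁻ p q (subst (_ ∈_) (sym p∩q≡⁅y⁆) (x∈⁅x⁆ _))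

module EdgesMeetingInOnePoint
  {F : List (Subset n)} (is3 : Is3Graph F) (intersecting : Intersecting F)
  {E D : Subset n} {u : Fin n} (E∈F : E List.∈ F) (D∈F : D List.∈ F) (E∩D≡⁅u⁆ : E ∩ D ≡ ⁅ u ⁆)
  where

  avoiding-u⇒outside-E∪D-unique : ∀ {G} → G List.∈ F → u ∉ G → a ∈ G → b ∈ G →
                                  a ∉ E ∪ D → b ∉ E ∪ D → a ≡ b
  avoiding-u⇒outside-E∪D-unique {a = a} {b = b} {G = G} G∈F u∉G a∈G b∈G a∉E∪D b∉E∪D
    with z , z∈G∩E ← intersecting G E G∈F E∈F
    with z′ , z′∈G∩D ← intersecting G D G∈F D∈F
    with z∈G , z∈E ← x∈p∩q⁻ G E z∈G∩E
    with z′∈G , z′∈D ← x∈p∩q⁻ G D z′∈G∩D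
    = a-is-b (∣p∣≡3⇒x≡a⊎x≡b⊎x≡c (is3 G G∈F) z∈G z′∈G b∈G z≢z′
                (x∈p⇒y∉p⇒x≢y z∈E (x∉p∪q⇒x∉p b∉E∪D)) (x∈p⇒y∉p⇒x≢y z′∈D (x∉p∪q⇒x∉q b∉E∪D)) a∈G)
    where
    z≢z′ : z ≢ z′
    z≢z′ refl = u∉G (subst (_∈ G) (p∩q≡⁅y⁆⇒x≡y E∩D≡⁅u⁆ z∈E z′∈D) z∈G)
    a-is-b : a ≡ z ⊎ a ≡ z′ ⊎ a ≡ b → a ≡ b
    a-is-b (inj₁ refl)        = ⊥-elim (x∉p∪q⇒x∉p a∉E∪D z∈E)
    a-is-b (inj₂ (inj₁ refl)) = ⊥-elim (x∉p∪q⇒x∉q a∉E∪D z′∈D)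
    a-is-b (inj₂ (inj₂ a≡b))  = a≡b

  two-outside-vertices⇒u∈ : ∀ {G} → G List.∈ F → a ∈ G → b ∈ G →
                            a ∉ E ∪ D → b ∉ E ∪ D → a ≢ b → u ∈ G
  two-outside-vertices⇒u∈ {G = G} G∈F a∈G b∈G a∉E∪D b∉E∪D a≢b with u ∈? G
  ... | yes u∈G = u∈G
  ... | no u∉G  = contradiction (avoiding-u⇒outside-E∪D-unique G∈F u∉G a∈G b∈G a∉E∪D b∉E∪D) a≢b

  three-outside-vertices⇒⊥ : CoversPairs F → SinglePointProperty F →
                             a ∉ E ∪ D → b ∉ E ∪ D → c ∉ E ∪ D → a ≢ b → a ≢ c → b ≢ c → ⊥
  three-outside-vertices⇒⊥ {a = a} {b = b} {c = c}
                           coversPairs singlePoint a∉E∪D b∉E∪D c∉E∪D a≢b a≢c b≢c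
    with G , G∈F , a∈G , b∈G ← coversPairs a b a≢b
    with G′ , G′∈F , b∈G′ , c∈G′ ← coversPairs b c b≢c
    with H , H∈F , G∩H≡⁅a⁆ ← singlePoint G G∈F a a∈G
    with t , t∈H∩G′ ← intersecting H G′ H∈F G′∈F
    with t∈H , t∈G′ ← x∈p∩q⁻ H G′ t∈H∩G′
    = t∉⁅u,b,c⁆ (∣p∣≡3⇒x≡a⊎x≡b⊎x≡c (is3 G′ G′∈F) u∈G′ b∈G′ c∈G′
                   (u≢outside b∉E∪D) (u≢outside c∉E∪D) b≢c t∈G′)
    where
    u≢outside : ∀ {w} → w ∉ E ∪ D → u ≢ w
    u≢outside w∉E∪D = x∈p⇒y∉p⇒x≢y (proj₁ (p∩q≡⁅y⁆⇒y∈p×y∈q E D E∩D≡⁅u⁆)) (x∉p∪q⇒x∉p w∉E∪D)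
    u∈G′ = two-outside-vertices⇒u∈ G′∈F b∈G′ c∈G′ b∉E∪D c∉E∪D b≢c
    u∈G = two-outside-vertices⇒u∈ G∈F a∈G b∈G a∉E∪D b∉E∪D a≢b
    u∉H : u ∉ H
    u∉H u∈H = u≢outside a∉E∪D (p∩q≡⁅y⁆⇒x≡y G∩H≡⁅a⁆ u∈G u∈H)
    t∉⁅u,b,c⁆ : t ≡ u ⊎ t ≡ b ⊎ t ≡ c → ⊥
    t∉⁅u,b,c⁆ (inj₁ refl)        = u∉H t∈H
    t∉⁅u,b,c⁆ (inj₂ (inj₁ refl)) = a≢b (sym (p∩q≡⁅y⁆⇒x≡y G∩H≡⁅a⁆ b∈G t∈H))
    t∉⁅u,b,c⁆ (inj₂ (inj₂ refl)) =
      a≢c (avoiding-u⇒outside-E∪D-unique H∈F u∉H a∈H t∈H a∉E∪D c∉E∪D)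
      where a∈H = proj₂ (p∩q≡⁅y⁆⇒y∈p×y∈q G H G∩H≡⁅a⁆)

edge-through-zero : {F : List (Subset (suc (suc n)))} → CoversPairs F →
                    ∃ λ E → E List.∈ F × zero ∈ E
edge-through-zero coversPairs with E , E∈F , 0∈E , _ ← coversPairs zero (suc zero) (λ ())
  = E , E∈F , 0∈E

8≤n⇒⊥ : {F : List (Subset n)} → Is3Graph F → Intersecting F → CoversPairs F →
        SinglePointProperty F → 8 ≤ n → ⊥
8≤n⇒⊥ {n = suc (suc k)} is3 intersecting coversPairs singlePoint 8≤n@(s≤s (s≤s _)) =
  let E , E∈F , 0∈E = edge-through-zero coversPairs
      D , D∈F , E∩D≡⁅0⁆ = singlePoint E E∈F zero 0∈E
      ∣E∪D∣≡5 = ∣p∣≡3⇒∣q∣≡3⇒∣p∩q∣≡1⇒∣p∪q∣≡5 E D (is3 E E∈F) (is3 D D∈F)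
                  (trans (cong ∣_∣ E∩D≡⁅0⁆) (∣⁅x⁆∣≡1 {n = suc (suc k)} zero))
      a , b , c , a∉E∪D , b∉E∪D , c∉E∪D , a≢b , a≢c , b≢c =
        three-distinct-∉ (E ∪ D) (subst (λ m → 3 + m ≤ _) (sym ∣E∪D∣≡5) 8≤n)
  in EdgesMeetingInOnePoint.three-outside-vertices⇒⊥ is3 intersecting {u = zero} E∈F D∈F E∩D≡⁅0⁆
       coversPairs singlePoint a∉E∪D b∉E∪D c∉E∪D a≢b a≢c b≢c

lemma3p13 : (n : ℕ) (F : List (Subset n)) → Is3Graph F → Intersecting F → CoversPairs F
            → SinglePointProperty F → n ≤ 7
lemma3p13 n F is3 intersecting coversPairs singlePoint with n ≤? 7
... | yes n≤7 = n≤7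
... | no n≰7  = ⊥-elim (8≤n⇒⊥ is3 intersecting coversPairs singlePoint (≰⇒> n≰7))
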